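{- Let $j \in \{5,6,7\}$ and $k \ge 2$. Let $I_j^k$ be the graph with vertex set $\{w_\ell^i : 1\le i\le k,\ 0 \le \ell \le j\}$ whose edges are: for each $i \in [k]$, the edges $w_0^i w_\ell^i$ and $w_\ell^i w_{\ell+1}^i$ for all $\ell \in [j]$ (so that $w^i_0,\dots,w^i_j$ span a wheel with center $w_0^i$ and rim cycle $w_1^i w_2^i\cdots w_j^i$); and, for all $1 \le i < i^* \le k$ and all $\ell \in [j]$, the edges $w_\ell^i w_\ell^{i^*}$ and $w_\ell^i w_{\ell+1}^{i^*}$. Here subscripts on rim vertices are taken with $j+1 := 1$. Then $I_j^k$ is $C_4$-induced-saturated.
   Context: All graphs are finite and simple; $C_4$ is the cycle on four vertices and $[m]=\{1,\dots,m\}$. For a graph $H$, a graph $G$ is $H$-induced-saturated if $G$ contains no induced subgraph isomorphic to $H$, but for every pair of distinct vertices $u,v$ of $G$, the graph obtained from $G$ by adding the edge $uv$ (if $uv\notin E(G)$) or deleting it (if $uv\in E(G)$) contains an induced subgraph isomorphic to $H$. -}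

module Defs where

open import Data.Nat using (ℕ; zero; suc; _+_; _≤_; _<_)
open import Data.Fin using (Fin; toℕ)
open import Data.Product using (Σ; _×_; _,_)
open import Data.Sum using (_⊎_)
open import Relation.Nullary using (¬_)
open import Relation.Binary.PropositionalEquality using (_≡_; _≢_)
open import Function.Bundles using (_⇔_)
open import Function.Definitions using (Injective)

-- A (simple) graph is given by a vertex type V and an adjacency relation
-- Adj : V → V → Set (symmetric and irreflexive for the graphs considered).

C4Adj : Fin 4 → Fin 4 → Set
C4Adj x y = (toℕ y ≡ suc (toℕ x)) ⊎ (toℕ x ≡ suc (toℕ y))
          ⊎ ((toℕ x ≡ 0) × (toℕ y ≡ 3)) ⊎ ((toℕ x ≡ 3) × (toℕ y ≡ 0))

HasInducedC4 : (V : Set) → (V → V → Set) → Set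
HasInducedC4 V Adj =
  Σ (Fin 4 → V) λ f → Injective _≡_ _≡_ f × (∀ x y → Adj (f x) (f y) ⇔ C4Adj x y)

SamePair : {V : Set} → V → V → V → V → Set
SamePair u v x y = ((x ≡ u) × (y ≡ v)) ⊎ ((x ≡ v) × (y ≡ u))

Flip : {V : Set} → (V → V → Set) → V → V → V → V → Set
Flip Adj u v x y = (SamePair u v x y × ¬ Adj x y) ⊎ (¬ SamePair u v x y × Adj x y)

C4InducedSaturated : (V : Set) → (V → V → Set) → Set
C4InducedSaturated V Adj =
  ¬ HasInducedC4 V Adj × (∀ (u v : V) → u ≢ v → HasInducedC4 V (Flip Adj u v))

rimNext : ℕ → ℕ → ℕ
rimNext j ℓ with ℓ Data.Nat.≟ j
... | Relation.Nullary.yes _ = 1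
... | Relation.Nullary.no _ = suc ℓ

-- Vertex w_ℓ^i is represented as (i , ℓ) with i : Fin k (i.e. copy i+1) and ℓ : Fin (suc j).
IV : ℕ → ℕ → Set
IV k j = Fin k × Fin (suc j)

IEdge : (k j : ℕ) → IV k j → IV k j → Set
IEdge k j (i , a) (i' , b) =
    ((i ≡ i') × (toℕ a ≡ 0) × (1 ≤ toℕ b))
  ⊎ ((i ≡ i') × (1 ≤ toℕ a) × (toℕ b ≡ rimNext j (toℕ a)))
  ⊎ ((toℕ i < toℕ i') × (1 ≤ toℕ a) × ((toℕ b ≡ toℕ a) ⊎ (toℕ b ≡ rimNext j (toℕ a))))

IAdj : (k j : ℕ) → IV k j → IV k j → Set
IAdj k j x y = IEdge k j x y ⊎ IEdge k j y x

-- Whether w^i_a and w^{i'}_b are adjacent depends only on a, b and the order of i and i'.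
-- Hence a strictly monotone map of copy indices embeds I^m_j into I^k_j as an induced
-- subgraph, and such embeddings commute with flipping a pair.  An induced C4 meets at most
-- four copies, so deleting copies it avoids moves it into I^4_j; a pair of vertices lies in at
-- most two copies, so the C4 created by flipping it can be found inside I^2_j.  For
-- j = 5, 6, 7 these two finite facts (no induced C4 in I^4_j, and an induced C4 in every
-- flip of I^2_j) are decided by a boolean search over vertex coordinates.

module Submission where

open import Defs
open import Data.Bool using (Bool; true; false; T; not; _∧_; _∨_)
open import Data.Bool.Properties using (T-∧; T-∨)
open import Data.Empty using (⊥-elim)
open import Data.Unit using (tt)
open import Data.Fin as Fin using (Fin; zero; suc; toℕ; inject≤; punchIn; punchOut; _<_)
open import Data.Fin.Patterns using (0F; 1F; 2F; 3F)
open import Data.Fin.Properties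
  using (toℕ-injective; toℕ-inject≤; <-cmp; <⇒≢; ≤∧≢⇒<; punchIn-mono-≤; punchIn-injective;
         punchIn-punchOut; any?; all?; ¬∀⟶∃¬; pigeonhole)
open import Data.Nat as ℕ using (ℕ; zero; suc; _+_; _≤_; _≤ᵇ_; _≡ᵇ_; z≤n; s≤s; z<s)
import Data.Nat.Properties as ℕ
open import Data.Product using (∃; ∃₂; _×_; _,_; proj₁; proj₂; uncurry)
open import Data.Product.Function.NonDependent.Propositional using (_×-⇔_)
open import Data.Product.Properties using (,-injective)
open import Data.Sum using (_⊎_; inj₁; inj₂; [_,_]; swap)
open import Data.Sum.Function.Propositional using (_⊎-⇔_)
open import Function using (_∘_; const)
open import Function.Bundles using (_⇔_; mk⇔; Equivalence)
open import Function.Construct.Composition using (_⇔-∘_)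
open import Function.Construct.Identity using (⇔-id)
open import Function.Construct.Symmetry using (⇔-sym)
open import Function.Definitions using (Injective)
open import Function.Related.TypeIsomorphisms using (¬-cong-⇔)
open import Relation.Binary
  using (Decidable; DecidableEquality; Symmetric; tri<; tri≈; tri>; _Preserves_⟶_)
open import Relation.Binary.PropositionalEquality
  using (_≡_; _≢_; refl; sym; trans; cong; cong₂; subst; subst₂; ≢-sym)
open import Relation.Nullary using (¬_; Dec; yes; no; does; ¬?)
open import Relation.Nullary.Decidable
  using (_×-dec_; _⊎-dec_; map′; True; False; toWitness; toWitnessFalse; decidable-stable)
open import Relation.Nullary.Negation using (contradiction)

open Equivalence using (to; from)

C4Adj? : Decidable C4Adj
C4Adj? x y = toℕ y ℕ.≟ suc (toℕ x) ⊎-dec toℕ x ℕ.≟ suc (toℕ y)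
  ⊎-dec (toℕ x ℕ.≟ 0 ×-dec toℕ y ℕ.≟ 3) ⊎-dec (toℕ x ℕ.≟ 3 ×-dec toℕ y ℕ.≟ 0)

record Square {V : Set} (Adj : V → V → Set) (a b c d : V) : Set where
  field
    a~b : Adj a b
    b~c : Adj b c
    c~d : Adj c d
    d~a : Adj d a
    a≁c : ¬ Adj a c
    b≁d : ¬ Adj b d
    a≢c : a ≢ c
    b≢d : b ≢ d

module _ {V : Set} {Adj : V → V → Set} where

  inducedC4⇒square : (c4 : HasInducedC4 V Adj) →
    let f = proj₁ c4 in Square Adj (f 0F) (f 1F) (f 2F) (f 3F)
  inducedC4⇒square (f , f-injective , f-adjacency) = record
    { a~b = edge 0F 1F ; b~c = edge 1F 2F ; c~d = edge 2F 3F ; d~a = edge 3F 0F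
    ; a≁c = nonEdge 0F 2F ; b≁d = nonEdge 1F 3F
    ; a≢c = 0F≢2F ∘ f-injective ; b≢d = 1F≢3F ∘ f-injective }
    where
    edge : ∀ x y → {True (C4Adj? x y)} → Adj (f x) (f y)
    edge x y {t} = from (f-adjacency x y) (toWitness t)
    nonEdge : ∀ x y → {False (C4Adj? x y)} → ¬ Adj (f x) (f y)
    nonEdge x y {t} = toWitnessFalse t ∘ to (f-adjacency x y)
    0F≢2F : 0F ≢ 2F
    0F≢2F ()
    1F≢3F : 1F ≢ 3F
    1F≢3F ()

  module _ (Adj-sym : Symmetric Adj) (Adj-irrefl : ∀ x → ¬ Adj x x) where

    adjacent⇒≢ : ∀ {x y} → Adj x y → x ≢ y
    adjacent⇒≢ x~y refl = Adj-irrefl _ x~y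

    square⇒inducedC4 : ∀ {a b c d} → Square Adj a b c d → HasInducedC4 V Adj
    square⇒inducedC4 {a} {b} {c} {d} sq = cycle , injective , adjacency
      where
      open Square sq
      cycle : Fin 4 → V
      cycle 0F = a
      cycle 1F = b
      cycle 2F = c
      cycle 3F = d

      injective : Injective _≡_ _≡_ cycle
      injective {0F} {0F} _ = refl
      injective {0F} {1F} = ⊥-elim ∘ adjacent⇒≢ a~b
      injective {0F} {2F} = ⊥-elim ∘ a≢c
      injective {0F} {3F} = ⊥-elim ∘ adjacent⇒≢ (Adj-sym d~a)
      injective {1F} {0F} = ⊥-elim ∘ adjacent⇒≢ (Adj-sym a~b)
      injective {1F} {1F} _ = refl
      injective {1F} {2F} = ⊥-elim ∘ adjacent⇒≢ b~c
      injective {1F} {3F} = ⊥-elim ∘ b≢d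
      injective {2F} {0F} = ⊥-elim ∘ a≢c ∘ sym
      injective {2F} {1F} = ⊥-elim ∘ adjacent⇒≢ (Adj-sym b~c)
      injective {2F} {2F} _ = refl
      injective {2F} {3F} = ⊥-elim ∘ adjacent⇒≢ c~d
      injective {3F} {0F} = ⊥-elim ∘ adjacent⇒≢ d~a
      injective {3F} {1F} = ⊥-elim ∘ b≢d ∘ sym
      injective {3F} {2F} = ⊥-elim ∘ adjacent⇒≢ (Adj-sym c~d)
      injective {3F} {3F} _ = refl

      edge : ∀ {p q x y} {x~y : True (C4Adj? x y)} → Adj p q → Adj p q ⇔ C4Adj x y
      edge {x~y = x~y} p~q = mk⇔ (const (toWitness x~y)) (const p~q)
      nonEdge : ∀ {p q x y} {x≁y : False (C4Adj? x y)} → ¬ Adj p q → Adj p q ⇔ C4Adj x y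
      nonEdge {x≁y = x≁y} p≁q = mk⇔ (⊥-elim ∘ p≁q) (⊥-elim ∘ toWitnessFalse x≁y)

      adjacency : ∀ x y → Adj (cycle x) (cycle y) ⇔ C4Adj x y
      adjacency 0F 0F = nonEdge (Adj-irrefl a)
      adjacency 0F 1F = edge a~b
      adjacency 0F 2F = nonEdge a≁c
      adjacency 0F 3F = edge (Adj-sym d~a)
      adjacency 1F 0F = edge (Adj-sym a~b)
      adjacency 1F 1F = nonEdge (Adj-irrefl b)
      adjacency 1F 2F = edge b~c
      adjacency 1F 3F = nonEdge b≁d
      adjacency 2F 0F = nonEdge (a≁c ∘ Adj-sym)
      adjacency 2F 1F = edge (Adj-sym b~c)
      adjacency 2F 2F = nonEdge (Adj-irrefl c)
      adjacency 2F 3F = edge c~d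
      adjacency 3F 0F = edge d~a
      adjacency 3F 1F = nonEdge (b≁d ∘ Adj-sym)
      adjacency 3F 2F = edge (Adj-sym c~d)
      adjacency 3F 3F = nonEdge (Adj-irrefl d)

module _ {V : Set} {A : V → V → Set} {u v : V} where

  SamePair-swap : ∀ {x y} → SamePair u v x y → SamePair u v y x
  SamePair-swap (inj₁ (x≡u , y≡v)) = inj₂ (y≡v , x≡u)
  SamePair-swap (inj₂ (x≡v , y≡u)) = inj₁ (y≡u , x≡v)

  Flip-symmetric : Symmetric A → Symmetric (Flip A u v)
  Flip-symmetric A-sym (inj₁ (same , x≁y)) = inj₁ (SamePair-swap same , x≁y ∘ A-sym)
  Flip-symmetric A-sym (inj₂ (different , x~y)) = inj₂ (different ∘ SamePair-swap , A-sym x~y)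

  Flip-irreflexive : u ≢ v → (∀ x → ¬ A x x) → ∀ x → ¬ Flip A u v x x
  Flip-irreflexive u≢v _ _ (inj₁ (inj₁ (x≡u , x≡v) , _)) = u≢v (trans (sym x≡u) x≡v)
  Flip-irreflexive u≢v _ _ (inj₁ (inj₂ (x≡v , x≡u) , _)) = u≢v (trans (sym x≡u) x≡v)
  Flip-irreflexive _ A-irrefl x (inj₂ (_ , x~x)) = A-irrefl x x~x

record InducedEmbedding {V W : Set} (A : V → V → Set) (B : W → W → Set) : Set where
  field
    embed : V → W
    injective : Injective _≡_ _≡_ embed
    adjacency : ∀ x y → B (embed x) (embed y) ⇔ A x y

module _ {V W : Set} {A : V → V → Set} {B : W → W → Set} (e : InducedEmbedding A B) where
  open InducedEmbedding e

  map-inducedC4 : HasInducedC4 V A → HasInducedC4 W B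
  map-inducedC4 (f , f-injective , f-adjacency) =
    embed ∘ f , (λ eq → f-injective (injective eq)) ,
    λ x y → f-adjacency x y ⇔-∘ adjacency (f x) (f y)

  pullback-inducedC4 : (c4 : HasInducedC4 W B) → (∀ x → ∃ λ v → embed v ≡ proj₁ c4 x) →
    HasInducedC4 V A
  pullback-inducedC4 (f , f-injective , f-adjacency) lift = g , g-injective , g-adjacency
    where
    g : Fin 4 → V
    g = proj₁ ∘ lift
    g-lifts : ∀ x → embed (g x) ≡ f x
    g-lifts = proj₂ ∘ lift
    g-injective : Injective _≡_ _≡_ g
    g-injective {x} {y} eq = f-injective (trans (sym (g-lifts x)) (trans (cong embed eq) (g-lifts y)))
    g-adjacency : ∀ x y → A (g x) (g y) ⇔ C4Adj x y
    g-adjacency x y =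
      subst₂ (λ p q → B p q ⇔ C4Adj x y) (sym (g-lifts x)) (sym (g-lifts y)) (f-adjacency x y)
        ⇔-∘ ⇔-sym (adjacency (g x) (g y))

  flip-embedding : (u v : V) → InducedEmbedding (Flip A u v) (Flip B (embed u) (embed v))
  flip-embedding u v = record { embed = embed ; injective = injective ; adjacency = flip-adjacency }
    where
    ≡-reflected : ∀ x y → (embed x ≡ embed y) ⇔ (x ≡ y)
    ≡-reflected x y = mk⇔ injective (cong embed)
    samePair : ∀ x y → SamePair (embed u) (embed v) (embed x) (embed y) ⇔ SamePair u v x y
    samePair x y =
      (≡-reflected x u ×-⇔ ≡-reflected y v) ⊎-⇔ (≡-reflected x v ×-⇔ ≡-reflected y u)
    flip-adjacency : ∀ x y → Flip B (embed u) (embed v) (embed x) (embed y) ⇔ Flip A u v x y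
    flip-adjacency x y =
          (samePair x y ×-⇔ ¬-cong-⇔ (adjacency x y))
      ⊎-⇔ (¬-cong-⇔ (samePair x y) ×-⇔ adjacency x y)

surjective⇒≤ : ∀ {m n} (f : Fin m → Fin n) → (∀ i → ∃ λ x → f x ≡ i) → n ℕ.≤ m
surjective⇒≤ f preimage = ℕ.≮⇒≥ λ m<n →
  let i , i' , i<i' , same = pigeonhole m<n (proj₁ ∘ preimage)
  in <⇒≢ i<i' (trans (sym (proj₂ (preimage i))) (trans (cong f same) (proj₂ (preimage i'))))

missedValue : ∀ {m n} → m ℕ.< n → (f : Fin m → Fin n) → ∃ λ i → ∀ x → f x ≢ i
missedValue {m} m<n f with any? (λ i → all? (λ x → ¬? (f x Fin.≟ i)))
... | yes missed = missed
... | no ¬missed = contradiction m<n (ℕ.≤⇒≯ (surjective⇒≤ f preimage))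
  where
  preimage : ∀ i → ∃ λ x → f x ≡ i
  preimage i =
    let x , ¬fx≢i = ¬∀⟶∃¬ m (λ x → f x ≢ i) (λ x → ¬? (f x Fin.≟ i)) (¬missed ∘ (i ,_))
    in x , decidable-stable (f x Fin.≟ i) ¬fx≢i

module _ {k j : ℕ} where

  IAdj-symmetric : Symmetric (IAdj k j)
  IAdj-symmetric = swap

  rimNext-≢ : j ≢ 1 → ∀ ℓ → rimNext j ℓ ≢ ℓ
  rimNext-≢ j≢1 ℓ with ℓ ℕ.≟ j
  ... | yes refl = j≢1 ∘ sym
  ... | no _ = ℕ.1+n≢n

  IEdge-irreflexive : j ≢ 1 → ∀ x → ¬ IEdge k j x x
  IEdge-irreflexive _ _ (inj₁ (_ , ℓ≡0 , 1≤ℓ)) = ℕ.<-irrefl (sym ℓ≡0) 1≤ℓ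
  IEdge-irreflexive j≢1 _ (inj₂ (inj₁ (_ , _ , ℓ≡next))) = rimNext-≢ j≢1 _ (sym ℓ≡next)
  IEdge-irreflexive _ _ (inj₂ (inj₂ (i<i , _))) = ℕ.<-irrefl refl i<i

  IAdj-irreflexive : j ≢ 1 → ∀ x → ¬ IAdj k j x x
  IAdj-irreflexive j≢1 x = [ IEdge-irreflexive j≢1 x , IEdge-irreflexive j≢1 x ]

module _ {m k : ℕ} (e : Fin m → Fin k) (e-mono : e Preserves _<_ ⟶ _<_) where

  strictlyMonotone⇒injective : Injective _≡_ _≡_ e
  strictlyMonotone⇒injective {x} {y} ex≡ey with <-cmp x y
  ... | tri< x<y _ _ = contradiction ex≡ey (<⇒≢ (e-mono x<y))
  ... | tri≈ _ x≡y _ = x≡y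
  ... | tri> _ _ y<x = contradiction (sym ex≡ey) (<⇒≢ (e-mono y<x))

  strictlyMonotone⇒reflects-< : ∀ {x y} → e x < e y → x < y
  strictlyMonotone⇒reflects-< {x} {y} ex<ey with <-cmp x y
  ... | tri< x<y _ _ = x<y
  ... | tri≈ _ refl _ = contradiction ex<ey (ℕ.<-irrefl refl)
  ... | tri> _ _ y<x = contradiction ex<ey (ℕ.<-asym (e-mono y<x))

  copyEmbedding : ∀ {j} → InducedEmbedding (IAdj m j) (IAdj k j)
  copyEmbedding {j} = record
    { embed = λ (i , ℓ) → e i , ℓ
    ; injective = λ eq → let same-copy , same-label = ,-injective eq
                         in cong₂ _,_ (strictlyMonotone⇒injective same-copy) same-label
    ; adjacency = λ x y → edge x y ⊎-⇔ edge y x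
    }
    where
    edge : ∀ x y → IEdge k j (e (proj₁ x) , proj₂ x) (e (proj₁ y) , proj₂ y) ⇔ IEdge m j x y
    edge (i , a) (i' , b) =
            (copy-≡ ×-⇔ ⇔-id _ ×-⇔ ⇔-id _)
      ⊎-⇔ (copy-≡ ×-⇔ ⇔-id _ ×-⇔ ⇔-id _)
      ⊎-⇔ (copy-< ×-⇔ ⇔-id _ ×-⇔ ⇔-id _)
      where
      copy-≡ : (e i ≡ e i') ⇔ (i ≡ i')
      copy-≡ = mk⇔ strictlyMonotone⇒injective (cong e)
      copy-< : (e i < e i') ⇔ (i < i')
      copy-< = mk⇔ strictlyMonotone⇒reflects-< e-mono

inject≤-mono : ∀ {m k} (m≤k : m ≤ k) → (λ i → inject≤ i m≤k) Preserves _<_ ⟶ _<_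
inject≤-mono m≤k {x} {y} = subst₂ ℕ._<_ (sym (toℕ-inject≤ x m≤k)) (sym (toℕ-inject≤ y m≤k))

punchIn-mono : ∀ {n} (i : Fin (suc n)) → punchIn i Preserves _<_ ⟶ _<_
punchIn-mono i {x} {y} x<y =
  ≤∧≢⇒< (punchIn-mono-≤ i x y (ℕ.<⇒≤ x<y)) (<⇒≢ x<y ∘ punchIn-injective i x y)

twoPoint : ∀ {k} → Fin k → Fin k → Fin 2 → Fin k
twoPoint x y 0F = x
twoPoint x y 1F = y

twoPoint-mono : ∀ {k} {x y : Fin k} → x < y → twoPoint x y Preserves _<_ ⟶ _<_
twoPoint-mono x<y {0F} {1F} _ = x<y
twoPoint-mono x<y {1F} {1F} (s≤s ())

module _ {j : ℕ} where

  inducedC4-in-I4 : ∀ k → HasInducedC4 (IV k j) (IAdj k j) → HasInducedC4 (IV 4 j) (IAdj 4 j)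
  inducedC4-in-I4 k c4 with k ℕ.≤? 4
  ... | yes k≤4 = map-inducedC4 (copyEmbedding (λ i → inject≤ i k≤4) (inject≤-mono k≤4)) c4
  inducedC4-in-I4 zero c4 | no 0≰4 = contradiction z≤n 0≰4
  inducedC4-in-I4 (suc n) c4 | no 1+n≰4 =
    inducedC4-in-I4 n (pullback-inducedC4 (copyEmbedding (punchIn unused) (punchIn-mono unused)) c4 lift)
    where
    f : Fin 4 → IV (suc n) j
    f = proj₁ c4
    unusedCopy : ∃ λ i → ∀ x → proj₁ (f x) ≢ i
    unusedCopy = missedValue (ℕ.≰⇒> 1+n≰4) (proj₁ ∘ f)
    unused : Fin (suc n)
    unused = proj₁ unusedCopy
    lift : ∀ x → ∃ λ w → (punchIn unused (proj₁ w) , proj₂ w) ≡ f x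
    lift x = (punchOut (≢-sym (proj₂ unusedCopy x)) , proj₂ (f x)) ,
             cong₂ _,_ (punchIn-punchOut _) refl

  twoPoint-cover₁ : ∀ {n} (i : Fin (2 + n)) →
    ∃ λ (e : Fin 2 → Fin (2 + n)) → e Preserves _<_ ⟶ _<_ × ∃ λ p → e p ≡ i
  twoPoint-cover₁ 0F = twoPoint 0F 1F , twoPoint-mono z<s , 0F , refl
  twoPoint-cover₁ (suc i) = twoPoint 0F (suc i) , twoPoint-mono z<s , 1F , refl

  twoPoint-cover₂ : ∀ {n} (i i' : Fin (2 + n)) →
    ∃ λ (e : Fin 2 → Fin (2 + n)) → e Preserves _<_ ⟶ _<_ × ∃₂ λ p q → e p ≡ i × e q ≡ i'
  twoPoint-cover₂ i i' with <-cmp i i'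
  ... | tri< i<i' _ _ = twoPoint i i' , twoPoint-mono i<i' , 0F , 1F , refl , refl
  ... | tri> _ _ i'<i = twoPoint i' i , twoPoint-mono i'<i , 1F , 0F , refl , refl
  ... | tri≈ _ refl _ =
    let e , e-mono , p , ep≡i = twoPoint-cover₁ i in e , e-mono , p , p , ep≡i , ep≡i

  saturated-from-I2 : (∀ (u v : IV 2 j) → u ≢ v → HasInducedC4 (IV 2 j) (Flip (IAdj 2 j) u v)) →
    ∀ {n} (u v : IV (2 + n) j) → u ≢ v → HasInducedC4 (IV (2 + n) j) (Flip (IAdj (2 + n) j) u v)
  saturated-from-I2 saturated₂ (i , a) (i' , b) u≢v with twoPoint-cover₂ i i'
  ... | e , e-mono , p , q , refl , refl =
    map-inducedC4 (flip-embedding (copyEmbedding e e-mono) (p , a) (q , b))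
      (saturated₂ (p , a) (q , b) (u≢v ∘ cong λ (c , ℓ) → e c , ℓ))

coords : ∀ {k j} → IV k j → ℕ × ℕ
coords (i , ℓ) = toℕ i , toℕ ℓ

_==ᵇ_ : ℕ × ℕ → ℕ × ℕ → Bool
(m , a) ==ᵇ (n , b) = (m ≡ᵇ n) ∧ (a ≡ᵇ b)

edgeᵇ : ℕ → ℕ × ℕ → ℕ × ℕ → Bool
edgeᵇ j (m , a) (n , b) =
     (m ≡ᵇ n) ∧ (a ≡ᵇ 0) ∧ (1 ≤ᵇ b)
  ∨ (m ≡ᵇ n) ∧ (1 ≤ᵇ a) ∧ (b ≡ᵇ rimNext j a)
  ∨ (suc m ≤ᵇ n) ∧ (1 ≤ᵇ a) ∧ ((b ≡ᵇ a) ∨ (b ≡ᵇ rimNext j a))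

adjacentᵇ : ℕ → ℕ × ℕ → ℕ × ℕ → Bool
adjacentᵇ j x y = edgeᵇ j x y ∨ edgeᵇ j y x

flipᵇ : (ℕ × ℕ → ℕ × ℕ → Bool) → ℕ × ℕ → ℕ × ℕ → ℕ × ℕ → ℕ × ℕ → Bool
flipᵇ r u v x y = samePair ∧ not (r x y) ∨ not samePair ∧ r x y
  where
  samePair : Bool
  samePair = (x ==ᵇ u) ∧ (y ==ᵇ v) ∨ (x ==ᵇ v) ∧ (y ==ᵇ u)

-- The decision procedures below are built so that their boolean part is definitionally the
-- coordinate function they are paired with in computedBy (witnessed by refl); the searches
-- then evaluate only builtin ℕ comparisons, never the Dec terms.
≟-viaℕ : ∀ {n} → DecidableEquality (Fin n)
≟-viaℕ i i' = map′ toℕ-injective (cong toℕ) (toℕ i ℕ.≟ toℕ i')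

vertex-≟ : ∀ {k j} → DecidableEquality (IV k j)
vertex-≟ (i , a) (i' , b) = map′ (uncurry (cong₂ _,_)) ,-injective (≟-viaℕ i i' ×-dec ≟-viaℕ a b)

IEdge? : ∀ {k j} → Decidable (IEdge k j)
IEdge? {j = j} (i , a) (i' , b) =
        (≟-viaℕ i i' ×-dec toℕ a ℕ.≟ 0 ×-dec 1 ℕ.≤? toℕ b)
  ⊎-dec (≟-viaℕ i i' ×-dec 1 ℕ.≤? toℕ a ×-dec toℕ b ℕ.≟ rimNext j (toℕ a))
  ⊎-dec (toℕ i ℕ.<? toℕ i' ×-dec 1 ℕ.≤? toℕ a
           ×-dec (toℕ b ℕ.≟ toℕ a ⊎-dec toℕ b ℕ.≟ rimNext j (toℕ a)))

IAdj? : ∀ {k j} → Decidable (IAdj k j)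
IAdj? x y = IEdge? x y ⊎-dec IEdge? y x

Flip? : ∀ {V : Set} {A : V → V → Set} → DecidableEquality V → Decidable A →
  ∀ u v → Decidable (Flip A u v)
Flip? _≟_ A? u v x y = samePair? ×-dec ¬? (A? x y) ⊎-dec ¬? samePair? ×-dec A? x y
  where
  samePair? : Dec (SamePair u v x y)
  samePair? = (x ≟ u ×-dec y ≟ v) ⊎-dec (x ≟ v ×-dec y ≟ u)

does⇔ : ∀ {P : Set} (P? : Dec P) → P ⇔ T (does P?)
does⇔ (yes p) = mk⇔ (const _) (const p)
does⇔ (no ¬p) = mk⇔ ¬p λ ()

module _ {k j : ℕ} where

  record Computes (R : IV k j → IV k j → Set) (r : ℕ × ℕ → ℕ × ℕ → Bool) : Set where
    constructor computes
    field reflects : ∀ x y → R x y ⇔ T (r (coords x) (coords y))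
  open Computes public

  computedBy : ∀ {R r} (R? : Decidable R) → (∀ x y → does (R? x y) ≡ r (coords x) (coords y)) →
    Computes R r
  computedBy {R} R? does≡r = computes λ x y → subst (λ b → R x y ⇔ T b) (does≡r x y) (does⇔ (R? x y))

  ≡-computed : Computes _≡_ _==ᵇ_
  ≡-computed = computedBy {r = _==ᵇ_} vertex-≟ λ _ _ → refl

  IAdj-computed : Computes (IAdj k j) (adjacentᵇ j)
  IAdj-computed = computedBy {r = adjacentᵇ j} IAdj? λ _ _ → refl

  Flip-computed : ∀ u v → Computes (Flip (IAdj k j) u v) (flipᵇ (adjacentᵇ j) (coords u) (coords v))
  Flip-computed u v =
    computedBy {r = flipᵇ (adjacentᵇ j) (coords u) (coords v)} (Flip? vertex-≟ IAdj? u v) λ _ _ → refl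

allBelow : ℕ → (ℕ → Bool) → Bool
allBelow zero p = true
allBelow (suc n) p = p 0 ∧ allBelow n (p ∘ suc)

anyBelow : ℕ → (ℕ → Bool) → Bool
anyBelow zero p = false
anyBelow (suc n) p = p 0 ∨ anyBelow n (p ∘ suc)

allBelow-sound : ∀ {n p} → T (allBelow n p) → ∀ (x : Fin n) → T (p (toℕ x))
allBelow-sound {suc n} t 0F = proj₁ (to T-∧ t)
allBelow-sound {suc n} t (suc x) = allBelow-sound {n} (proj₂ (to T-∧ t)) x

anyBelow-sound : ∀ {n p} → T (anyBelow n p) → ∃ λ (x : Fin n) → T (p (toℕ x))
anyBelow-sound {suc n} t with to T-∨ t
... | inj₁ p0 = 0F , p0
... | inj₂ rest = let x , px = anyBelow-sound {n} rest in suc x , px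

-- Labels range over 0..j; quantifying with allUpTo j rather than allBelow (suc j) keeps the
-- predicate recoverable by unification when j is a variable.
allUpTo anyUpTo : ℕ → (ℕ → Bool) → Bool
allUpTo zero p = p 0
allUpTo (suc n) p = p 0 ∧ allUpTo n (p ∘ suc)
anyUpTo zero p = p 0
anyUpTo (suc n) p = p 0 ∨ anyUpTo n (p ∘ suc)

allUpTo-sound : ∀ {n p} → T (allUpTo n p) → ∀ (x : Fin (suc n)) → T (p (toℕ x))
allUpTo-sound {zero} t 0F = t
allUpTo-sound {suc n} t 0F = proj₁ (to T-∧ t)
allUpTo-sound {suc n} t (suc x) = allUpTo-sound {n} (proj₂ (to T-∧ t)) x

anyUpTo-sound : ∀ {n p} → T (anyUpTo n p) → ∃ λ (x : Fin (suc n)) → T (p (toℕ x))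
anyUpTo-sound {zero} t = 0F , t
anyUpTo-sound {suc n} t with to T-∨ t
... | inj₁ p0 = 0F , p0
... | inj₂ rest = let x , px = anyUpTo-sound {n} rest in suc x , px

allVertices anyVertex : ℕ → ℕ → (ℕ × ℕ → Bool) → Bool
allVertices k j p = allBelow k λ m → allUpTo j λ ℓ → p (m , ℓ)
anyVertex k j p = anyBelow k λ m → anyUpTo j λ ℓ → p (m , ℓ)

module _ {k j : ℕ} where

  allVertices-sound : ∀ {p} → T (allVertices k j p) → ∀ (v : IV k j) → T (p (coords v))
  allVertices-sound t (i , ℓ) = allUpTo-sound (allBelow-sound t i) ℓ

  anyVertex-sound : ∀ {p} → T (anyVertex k j p) → ∃ λ (v : IV k j) → T (p (coords v))
  anyVertex-sound t =
    let i , t′ = anyBelow-sound t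
        ℓ , t″ = anyUpTo-sound t′
    in (i , ℓ) , t″

infixr 4 _⇒ᵇ_
_⇒ᵇ_ : Bool → Bool → Bool
true ⇒ᵇ b = b
false ⇒ᵇ _ = true

⇒ᵇ-elim : ∀ {a b} → T (a ⇒ᵇ b) → T a → T b
⇒ᵇ-elim {true} t _ = t

T-not⇔¬T : ∀ {b} → T (not b) ⇔ (¬ T b)
T-not⇔¬T {true} = mk⇔ (λ ()) (λ ¬t → ¬t _)
T-not⇔¬T {false} = mk⇔ (λ _ ()) (const _)

module _ (r : ℕ × ℕ → ℕ × ℕ → Bool) where

  apartᵇ : ℕ × ℕ → ℕ × ℕ → Bool
  apartᵇ x y = not (r x y ∨ x ==ᵇ y)

  extendsᵇ : (a b c : ℕ × ℕ) → Bool
  extendsᵇ a b c = r b c ∧ apartᵇ a c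

  closesᵇ : (a b c d : ℕ × ℕ) → Bool
  closesᵇ a b c d = r c d ∧ r d a ∧ apartᵇ b d

  -- A square a b c d is enumerated as the induced path a b c closed by d, pruning at each stage.
  noSquareᵇ : ℕ → ℕ → Bool
  noSquareᵇ k j =
    ∀ᵛ λ a → ∀ᵛ λ b → r a b ⇒ᵇ
    ∀ᵛ λ c → extendsᵇ a b c ⇒ᵇ
    ∀ᵛ λ d → not (closesᵇ a b c d)
    where
    ∀ᵛ : (ℕ × ℕ → Bool) → Bool
    ∀ᵛ = allVertices k j

  squareAtᵇ : ℕ → ℕ → ℕ × ℕ → Bool
  squareAtᵇ k j a =
    ∃ᵛ λ b → r a b ∧ ∃ᵛ λ c → extendsᵇ a b c ∧ ∃ᵛ λ d → closesᵇ a b c d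
    where
    ∃ᵛ : (ℕ × ℕ → Bool) → Bool
    ∃ᵛ = anyVertex k j

module _ {k j : ℕ} {R : IV k j → IV k j → Set} {r : ℕ × ℕ → ℕ × ℕ → Bool}
         (R≈r : Computes R r) where

  private
    ⟦_⟧ : ∀ {x y} → R x y → T (r (coords x) (coords y))
    ⟦_⟧ {x} {y} = to (reflects R≈r x y)

    ⟦_⟧⁻¹ : ∀ {x y} → T (r (coords x) (coords y)) → R x y
    ⟦_⟧⁻¹ {x} {y} = from (reflects R≈r x y)

    apart⇔ : ∀ x y → T (apartᵇ r (coords x) (coords y)) ⇔ (¬ R x y × x ≢ y)
    apart⇔ x y = mk⇔
      (λ t → let ¬t = to T-not⇔¬T t
             in ¬t ∘ from T-∨ ∘ inj₁ ∘ ⟦_⟧ , ¬t ∘ from T-∨ ∘ inj₂ ∘ to (reflects ≡-computed x y))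
      (λ (x≁y , x≢y) → from T-not⇔¬T
        ([ x≁y ∘ ⟦_⟧⁻¹ , x≢y ∘ from (reflects ≡-computed x y) ] ∘ to T-∨))

  extends⇔ : ∀ a b c → T (extendsᵇ r (coords a) (coords b) (coords c)) ⇔ (R b c × ¬ R a c × a ≢ c)
  extends⇔ a b c = (⇔-sym (reflects R≈r b c) ×-⇔ apart⇔ a c) ⇔-∘ T-∧

  closes⇔ : ∀ a b c d → T (closesᵇ r (coords a) (coords b) (coords c) (coords d)) ⇔
    (R c d × R d a × ¬ R b d × b ≢ d)
  closes⇔ a b c d =
    (⇔-sym (reflects R≈r c d) ×-⇔ ⇔-sym (reflects R≈r d a) ×-⇔ apart⇔ b d)
      ⇔-∘ ((⇔-id _ ×-⇔ T-∧) ⇔-∘ T-∧)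

  square⇒path : ∀ {a b c d} → Square R a b c d →
    T (r (coords a) (coords b)) × T (extendsᵇ r (coords a) (coords b) (coords c))
      × T (closesᵇ r (coords a) (coords b) (coords c) (coords d))
  square⇒path {a} {b} {c} {d} sq =
    ⟦ a~b ⟧ , from (extends⇔ a b c) (b~c , a≁c , a≢c) , from (closes⇔ a b c d) (c~d , d~a , b≁d , b≢d)
    where open Square sq

  path⇒square : ∀ {a b c d} →
    T (r (coords a) (coords b)) → T (extendsᵇ r (coords a) (coords b) (coords c)) →
    T (closesᵇ r (coords a) (coords b) (coords c) (coords d)) → Square R a b c d
  path⇒square {a} {b} {c} {d} ab extends closes
    with to (extends⇔ a b c) extends | to (closes⇔ a b c d) closes
  ... | b~c , a≁c , a≢c | c~d , d~a , b≁d , b≢d = record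
    { a~b = ⟦ ab ⟧⁻¹ ; b~c = b~c ; c~d = c~d ; d~a = d~a
    ; a≁c = a≁c ; b≁d = b≁d ; a≢c = a≢c ; b≢d = b≢d }

  noSquareᵇ-sound : T (noSquareᵇ r k j) → ∀ {a b c d} → ¬ Square R a b c d
  noSquareᵇ-sound check {a} {b} {c} {d} sq =
    let ab , extends , closes = square⇒path sq
    in to T-not⇔¬T
         (allVertices-sound (⇒ᵇ-elim (allVertices-sound (⇒ᵇ-elim (allVertices-sound
           (allVertices-sound check a) b) ab) c) extends) d)
         closes

  squareAtᵇ-sound : ∀ a → T (squareAtᵇ r k j (coords a)) →
    ∃₂ λ b c → ∃ λ d → Square R a b c d
  squareAtᵇ-sound a found with anyVertex-sound found
  ... | b , found-b with to T-∧ found-b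
  ... | ab , found-c with anyVertex-sound found-c
  ... | c , found-c′ with to T-∧ found-c′
  ... | extends , found-d with anyVertex-sound found-d
  ... | d , closes = b , c , d , path⇒square ab extends closes

-- Anchoring the search at u suffices when the graph itself has no induced C4: every induced
-- C4 of the flipped graph then contains u.
saturationᵇ : ℕ → ℕ → Bool
saturationᵇ k j =
  allVertices k j λ u → allVertices k j λ v → u ==ᵇ v ∨ squareAtᵇ (flipᵇ (adjacentᵇ j) u v) k j u

module _ {k j : ℕ} where

  noSquareᵇ⇒C4-free : T (noSquareᵇ (adjacentᵇ j) k j) → ¬ HasInducedC4 (IV k j) (IAdj k j)
  noSquareᵇ⇒C4-free check c4 = noSquareᵇ-sound IAdj-computed check (inducedC4⇒square c4)

  saturationᵇ⇒saturated : j ≢ 1 → T (saturationᵇ k j) →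
    ∀ (u v : IV k j) → u ≢ v → HasInducedC4 (IV k j) (Flip (IAdj k j) u v)
  saturationᵇ⇒saturated j≢1 check u v u≢v
    with to T-∨ (allVertices-sound (allVertices-sound check u) v)
  ... | inj₁ u≡v = contradiction (from (reflects ≡-computed u v) u≡v) u≢v
  ... | inj₂ found =
    let _ , _ , _ , square = squareAtᵇ-sound (Flip-computed u v) u found
    in square⇒inducedC4 flip-symmetric flip-irreflexive square
    where
    flip-symmetric : Symmetric (Flip (IAdj k j) u v)
    flip-symmetric = Flip-symmetric IAdj-symmetric
    flip-irreflexive : ∀ x → ¬ Flip (IAdj k j) u v x x
    flip-irreflexive = Flip-irreflexive {A = IAdj k j} u≢v (IAdj-irreflexive j≢1)

I-C4InducedSaturated : ∀ {j} → j ≢ 1 → T (noSquareᵇ (adjacentᵇ j) 4 j) → T (saturationᵇ 2 j) →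
  ∀ {k} → 2 ≤ k → C4InducedSaturated (IV k j) (IAdj k j)
I-C4InducedSaturated j≢1 free saturated (s≤s (s≤s _)) =
    noSquareᵇ⇒C4-free free ∘ inducedC4-in-I4 _
  , saturated-from-I2 (saturationᵇ⇒saturated j≢1 saturated)

proposition5p2 : (j k : ℕ) → (j ≡ 5 ⊎ j ≡ 6 ⊎ j ≡ 7) → 2 ≤ k →
    C4InducedSaturated (IV k j) (IAdj k j)
proposition5p2 _ _ (inj₁ refl) = I-C4InducedSaturated (λ ()) tt tt
proposition5p2 _ _ (inj₂ (inj₁ refl)) = I-C4InducedSaturated (λ ()) tt tt
proposition5p2 _ _ (inj₂ (inj₂ refl)) = I-C4InducedSaturated (λ ()) tt tt
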